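{- Let $(m,n)\in\mathbb Z_{>0}\times\mathbb Z$ be coprime and $d>0$. (i) For any interval $J=\{a,a+1,\dots,b\}\subseteq[dm]$, $\sum_{j\in J}\mathbf b(dm,dn)_j<|J|\frac nm+1$. (ii) For $J=\{a,a+1,\dots,dm\}$, $\sum_{j\in J}\mathbf b(dm,dn)_j\le|J|\frac nm$, with equality if and only if $a$ is one more than a multiple of $m$.
   Context: For $(M,N)\in\mathbb Z_{>0}\times\mathbb Z$, $\mathbf b(M,N)\in\mathbb Z^M$ is defined by $\mathbf b(M,N)_i=\lceil iN/M\rceil-\lceil(i-1)N/M\rceil$ for $i=1,\dots,M$; $[N]=\{1,\dots,N\}$. -}

module Defs where

open import Data.Nat using (ℕ; zero; suc; _+_; _∸_; NonZero)
open import Data.Integer as ℤ using (ℤ; +_)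
open import Data.Rational as ℚ using (ℚ; ceiling)

bvec : (M : ℕ) → .{{_ : NonZero M}} → ℤ → ℕ → ℤ
bvec M N i = ceiling (((+ i) ℤ.* N) ℚ./ M) ℤ.- ceiling (((+ (i ∸ 1)) ℤ.* N) ℚ./ M)

sumℤ : (ℕ → ℤ) → ℕ → ℤ
sumℤ f zero = + 0
sumℤ f (suc len) = sumℤ f len ℤ.+ f len

-- Σ_{j ∈ {a, a+1, …, b}} f j   (empty when b < a)
sumInterval : (ℕ → ℤ) → ℕ → ℕ → ℤ
sumInterval f a b = sumℤ (λ k → f (a + k)) (suc b ∸ a)

{-# OPTIONS --safe #-}
-- Since dn/dm = n/m, the entries of b(dm,dn) are the increments of C(i) = ⌈in/m⌉, so
-- interval sums telescope. Write C(i)·m = in + δ(i) with 0 ≤ δ(i) < m; then m times the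
-- sum over {a,…,b} is (b-a+1)n + δ(b) - δ(a-1), which gives (i). Since δ vanishes at
-- multiples of m, for b = dm the sum is at most |J|n/m, with equality iff δ(a-1) = 0,
-- i.e. iff m divides (a-1)n, i.e. (by coprimality) iff m divides a-1.
module Submission where

module Fraction where
  open import Data.Nat as ℕ using (suc; pred; NonZero)
  import Data.Nat.Properties as ℕ
  open import Data.Integer using (+_; _+_; _*_; _≤_; _<_)
  open import Data.Integer.Tactic.RingSolver using (solve-∀)
  open import Data.Rational as ℚ using (_/_; 1ℚ; toℚᵘ; ↥_; ↧_)
  import Data.Rational.Properties as ℚ
  open import Data.Rational.Unnormalised as ℚᵘ using (mkℚᵘ; _≃_; *≡*; *≤*; *<*)
  import Data.Rational.Unnormalised.Properties as ℚᵘ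
  open import Function.Bundles using (_⇔_; mk⇔)
  open import Relation.Binary.PropositionalEquality using (_≡_; sym; trans; cong)

  toℚᵘ-/ : ∀ x q .{{_ : NonZero q}} → toℚᵘ (x / q) ≃ mkℚᵘ x (pred q)
  toℚᵘ-/ x (suc q) = ℚ.toℚᵘ-fromℚᵘ (mkℚᵘ x q)

  ↥-/-cross : ∀ x q .{{_ : NonZero q}} → ↥ (x / q) * + q ≡ x * ↧ (x / q)
  ↥-/-cross x q@(suc _) = trans (cong (_* + q) (sym (ℚ.↥ᵘ-toℚᵘ (x / q))))
    (trans (ℚᵘ.drop-*≡* (toℚᵘ-/ x q)) (cong (x *_) (ℚ.↧ᵘ-toℚᵘ (x / q))))

  /-<-/ : ∀ x q z r .{{_ : NonZero q}} .{{_ : NonZero r}} →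
          x * + r < z * + q → x / q ℚ.< z / r
  /-<-/ x q@(suc _) z r@(suc _) xr<zq = ℚ.toℚᵘ-cancel-<
    (ℚᵘ.<-respˡ-≃ (ℚᵘ.≃-sym (toℚᵘ-/ x q)) (ℚᵘ.<-respʳ-≃ (ℚᵘ.≃-sym (toℚᵘ-/ z r)) (*<* xr<zq)))

  /-≤-/ : ∀ x q z r .{{_ : NonZero q}} .{{_ : NonZero r}} →
          x * + r ≤ z * + q → x / q ℚ.≤ z / r
  /-≤-/ x q@(suc _) z r@(suc _) xr≤zq = ℚ.toℚᵘ-cancel-≤
    (ℚᵘ.≤-respˡ-≃ (ℚᵘ.≃-sym (toℚᵘ-/ x q)) (ℚᵘ.≤-respʳ-≃ (ℚᵘ.≃-sym (toℚᵘ-/ z r)) (*≤* xr≤zq)))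

  /-≡-/ : ∀ x q z r .{{_ : NonZero q}} .{{_ : NonZero r}} →
          x * + r ≡ z * + q ⇔ x / q ≡ z / r
  /-≡-/ x q@(suc _) z r@(suc _) = mk⇔
    (λ xr≡zq → ℚ.toℚᵘ-injective
      (ℚᵘ.≃-trans (toℚᵘ-/ x q) (ℚᵘ.≃-trans (*≡* xr≡zq) (ℚᵘ.≃-sym (toℚᵘ-/ z r)))))
    (λ x/q≡z/r → ℚᵘ.drop-*≡*
      (ℚᵘ.≃-trans (ℚᵘ.≃-sym (toℚᵘ-/ x q)) (ℚᵘ.≃-trans (ℚ.toℚᵘ-cong x/q≡z/r) (toℚᵘ-/ z r))))

  /-+-1ℚ : ∀ y q .{{_ : NonZero q}} → y / q ℚ.+ 1ℚ ≡ (y + + q) / q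
  /-+-1ℚ y q@(suc q-1) = ℚ.toℚᵘ-injective (begin
      toℚᵘ (y / q ℚ.+ 1ℚ)               ≈⟨ ℚ.toℚᵘ-homo-+ (y / q) 1ℚ ⟩
      toℚᵘ (y / q) ℚᵘ.+ ℚᵘ.1ℚᵘ           ≈⟨ ℚᵘ.+-congˡ ℚᵘ.1ℚᵘ (toℚᵘ-/ y q) ⟩
      mkℚᵘ y q-1 ℚᵘ.+ ℚᵘ.1ℚᵘ            ≈⟨ *≡* cross ⟩
      mkℚᵘ (y + + q) q-1                ≈⟨ toℚᵘ-/ (y + + q) q ⟨
      toℚᵘ ((y + + q) / q)              ∎)
    where
    open ℚᵘ.≃-Reasoning
    identity : ∀ y q → (y * + 1 + + 1 * q) * q ≡ (y + q) * q
    identity = solve-∀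
    cross : (y * + 1 + + 1 * + q) * + q ≡ (y + + q) * + (q ℕ.* 1)
    cross rewrite ℕ.*-identityʳ q = identity y (+ q)

module Ceiling where
  open import Data.Nat using (suc; NonZero)
  open import Data.Integer using (ℤ; +_; _+_; -_; _*_; _≤_; _<_; +<+)
  import Data.Integer.Properties as ℤ
  import Data.Integer.DivMod as ℤ
  open import Data.Integer.Tactic.RingSolver using (solve-∀)
  open import Data.Rational as ℚ using (ℚ; _/_; ↥_; ↧_; floor; ceiling)
  import Data.Rational.Properties as ℚ
  open import Data.Product using (_×_; _,_)
  open import Relation.Binary.PropositionalEquality using (_≡_; cong; subst₂; module ≡-Reasoning)
  open Fraction using (↥-/-cross)

  floor-bounds : ∀ p → floor p * ↧ p ≤ ↥ p × ↥ p < floor p * ↧ p + ↧ p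
  floor-bounds p@record{} = ℤ.[n/d]*d≤n (↥ p) (↧ p) , (begin-strict
      ↥ p                                   ≡⟨ ℤ.a≡a%n+[a/n]*n (↥ p) (↧ p) ⟩
      + (↥ p ℤ.% ↧ p) + floor p * ↧ p       <⟨ ℤ.+-monoˡ-< (floor p * ↧ p) (+<+ (ℤ.n%d<d (↥ p) (↧ p))) ⟩
      ↧ p + floor p * ↧ p                   ≡⟨ ℤ.+-comm (↧ p) (floor p * ↧ p) ⟩
      floor p * ↧ p + ↧ p                   ∎)
    where open ℤ.≤-Reasoning

  ceiling-bounds : ∀ p → ↥ p ≤ ceiling p * ↧ p × ceiling p * ↧ p < ↥ p + ↧ p
  ceiling-bounds p@record{} with floor-bounds (ℚ.- p)
  ... | lower , upper =
      subst₂ _≤_ (ℤ.neg-involutive (↥ p)) (ℤ.neg-distribˡ-* f (↧ p)) (ℤ.neg-mono-≤ lower′)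
    , subst₂ _<_ (shift-left f (↧ p)) (shift-right (↥ p) (↧ p)) (ℤ.+-monoˡ-< (↧ p) (ℤ.neg-mono-< upper′))
    where
    f : ℤ
    f = floor (ℚ.- p)
    lower′ : f * ↧ p ≤ - ↥ p
    lower′ = subst₂ _≤_ (cong (f *_) (ℚ.↧-neg p)) (ℚ.↥-neg p) lower
    upper′ : - ↥ p < f * ↧ p + ↧ p
    upper′ = subst₂ _<_ (ℚ.↥-neg p) (cong (λ d → f * d + d) (ℚ.↧-neg p)) upper
    shift-left : ∀ f d → - (f * d + d) + d ≡ - f * d
    shift-left = solve-∀
    shift-right : ∀ u d → - - u + d ≡ u + d
    shift-right = solve-∀

  ceiling-/-bounds : ∀ x q .{{_ : NonZero q}} →
                     x ≤ ceiling (x / q) * + q × ceiling (x / q) * + q < x + + q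
  ceiling-/-bounds x q@(suc _) with ceiling-bounds (x / q)
  ... | lower , upper =
      ℤ.*-cancelʳ-≤-pos x (c * + q) (↧ p)
        (subst₂ _≤_ (↥-/-cross x q) (swap c (↧ p) (+ q)) (ℤ.*-monoʳ-≤-nonNeg (+ q) lower))
    , ℤ.*-cancelʳ-<-nonNeg (↧ p)
        (subst₂ _<_ (swap c (↧ p) (+ q)) shifted (ℤ.*-monoʳ-<-pos (+ q) upper))
    where
    p : ℚ
    p = x / q
    c : ℤ
    c = ceiling p
    swap : ∀ c d q → c * d * q ≡ c * q * d
    swap = solve-∀
    shifted : (↥ p + ↧ p) * + q ≡ (x + + q) * ↧ p
    shifted = begin
      (↥ p + ↧ p) * + q        ≡⟨ ℤ.*-distribʳ-+ (+ q) (↥ p) (↧ p) ⟩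
      ↥ p * + q + ↧ p * + q    ≡⟨ cong (_+ ↧ p * + q) (↥-/-cross x q) ⟩
      x * ↧ p + ↧ p * + q      ≡⟨ factor x (↧ p) (+ q) ⟩
      (x + + q) * ↧ p          ∎
      where
      open ≡-Reasoning
      factor : ∀ x d q → x * d + d * q ≡ (x + q) * d
      factor = solve-∀

module Telescoping where
  open import Defs using (sumℤ; sumInterval)
  open import Data.Nat using (ℕ; zero; suc; _∸_) renaming (_+_ to _+ℕ_; _≤_ to _≤ℕ_)
  import Data.Nat.Properties as ℕ
  open import Data.Integer using (ℤ; _+_; _-_)
  import Data.Integer.Properties as ℤ
  open import Data.Integer.Tactic.RingSolver using (solve-∀)
  open import Relation.Binary.PropositionalEquality using (_≡_; refl; sym; trans; cong; cong₂; module ≡-Reasoning)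

  sumℤ-cong : ∀ {f g} → (∀ k → f k ≡ g k) → ∀ len → sumℤ f len ≡ sumℤ g len
  sumℤ-cong f≗g zero      = refl
  sumℤ-cong f≗g (suc len) = cong₂ _+_ (sumℤ-cong f≗g len) (f≗g len)

  sumℤ-telescope : ∀ (F : ℕ → ℤ) a len →
                   sumℤ (λ k → F (suc (a +ℕ k)) - F (a +ℕ k)) len ≡ F (a +ℕ len) - F a
  sumℤ-telescope F a zero = trans (sym (ℤ.+-inverseʳ (F a))) (cong (λ i → F i - F a) (sym (ℕ.+-identityʳ a)))
  sumℤ-telescope F a (suc len) = begin
      sumℤ step len + step len                                  ≡⟨ cong (_+ step len) (sumℤ-telescope F a len) ⟩
      (F (a +ℕ len) - F a) + (F (suc (a +ℕ len)) - F (a +ℕ len)) ≡⟨ cancel (F (a +ℕ len)) (F a) (F (suc (a +ℕ len))) ⟩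
      F (suc (a +ℕ len)) - F a                                  ≡⟨ cong (λ i → F i - F a) (sym (ℕ.+-suc a len)) ⟩
      F (a +ℕ suc len) - F a                                    ∎
    where
    open ≡-Reasoning
    step : ℕ → ℤ
    step k = F (suc (a +ℕ k)) - F (a +ℕ k)
    cancel : ∀ x y z → (x - y) + (z - x) ≡ z - y
    cancel = solve-∀

  sumInterval-telescope : ∀ (f F : ℕ → ℤ) → (∀ j → f (suc j) ≡ F (suc j) - F j) →
                          ∀ {a b} → a ≤ℕ b → sumInterval f (suc a) b ≡ F b - F a
  sumInterval-telescope f F f≡ΔF {a} {b} a≤b = begin
      sumℤ (λ k → f (suc (a +ℕ k))) (b ∸ a)                      ≡⟨ sumℤ-cong (λ k → f≡ΔF (a +ℕ k)) (b ∸ a) ⟩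
      sumℤ (λ k → F (suc (a +ℕ k)) - F (a +ℕ k)) (b ∸ a)         ≡⟨ sumℤ-telescope F a (b ∸ a) ⟩
      F (a +ℕ (b ∸ a)) - F a                                    ≡⟨ cong (λ i → F i - F a) (ℕ.m+[n∸m]≡n a≤b) ⟩
      F b - F a                                                 ∎
    where open ≡-Reasoning

open import Data.Nat using (ℕ; NonZero)
open import Data.Integer using (ℤ)

module CeilingSequence (m : ℕ) .{{_ : NonZero m}} (n : ℤ) where
  open import Data.Nat as ℕ using (suc; _∸_; >-nonZero⁻¹)
  import Data.Nat.Properties as ℕ
  open import Data.Nat.Divisibility using (_∣_; divides)
  open import Data.Nat.Coprimality using (Coprime; coprime-divisor)
  open import Data.Integer using (+_; _+_; _-_; -_; _*_; _≤_; _<_; ∣_∣; 0ℤ; 1ℤ; +<+; Positive; positive; nonNegative)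
  import Data.Integer.Properties as ℤ
  open import Data.Integer.Tactic.RingSolver using (solve-∀)
  open import Data.Rational using (_/_; ceiling)
  open import Data.Product using (proj₁; proj₂)
  open import Relation.Binary.PropositionalEquality using (_≡_; refl; sym; trans; cong; cong₂; subst₂; module ≡-Reasoning)
  open import Algebra.Properties.AbelianGroup ℤ.+-0-abelianGroup using () renaming (∙-cancelˡ to +-cancelˡ-≡)
  open import Function.Bundles using (_⇔_; mk⇔; Equivalence)
  open import Defs using (bvec; sumInterval)
  open Telescoping using (sumInterval-telescope)
  open Fraction using (/-≡-/)
  open Ceiling using (ceiling-/-bounds)

  private instance
    m-positive : Positive (+ m)
    m-positive = positive (+<+ (>-nonZero⁻¹ m))

  ⌈_*n/m⌉ : ℕ → ℤ
  ⌈ i *n/m⌉ = ceiling ((+ i * n) / m)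

  defect : ℕ → ℤ
  defect i = ⌈ i *n/m⌉ * + m - + i * n

  defect-nonNeg : ∀ i → 0ℤ ≤ defect i
  defect-nonNeg i = ℤ.i≤j⇒0≤j-i (proj₁ (ceiling-/-bounds (+ i * n) m))

  defect<m : ∀ i → defect i < + m
  defect<m i = subst₂ _<_ refl (cancel (+ i * n) (+ m))
    (ℤ.+-monoˡ-< (- (+ i * n)) (proj₂ (ceiling-/-bounds (+ i * n) m)))
    where
    cancel : ∀ x q → x + q - x ≡ q
    cancel = solve-∀

  ⌈*n/m⌉-difference : ∀ {a b} → a ℕ.≤ b →
                      (⌈ b *n/m⌉ - ⌈ a *n/m⌉) * + m + defect a ≡ + (b ∸ a) * n + defect b
  ⌈*n/m⌉-difference {a} {b} a≤b with b ∸ a | ℕ.m+[n∸m]≡n a≤b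
  ... | t | refl = trans
    (identity ⌈ a ℕ.+ t *n/m⌉ ⌈ a *n/m⌉ (+ m) (+ a) (+ t) n)
    (cong (λ s → + t * n + (⌈ a ℕ.+ t *n/m⌉ * + m - s * n)) (sym (ℤ.pos-+ a t)))
    where
    identity : ∀ x y q a t n → (x - y) * q + (y * q - a * n) ≡ t * n + (x * q - (a + t) * n)
    identity = solve-∀

  ⌈*n/m⌉-difference-< : ∀ {a b} → a ℕ.≤ b → (⌈ b *n/m⌉ - ⌈ a *n/m⌉) * + m < + (b ∸ a) * n + + m
  ⌈*n/m⌉-difference-< {a} {b} a≤b = begin-strict
      (⌈ b *n/m⌉ - ⌈ a *n/m⌉) * + m                 ≤⟨ ℤ.i≤i+j _ (defect a) {{nonNegative (defect-nonNeg a)}} ⟩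
      (⌈ b *n/m⌉ - ⌈ a *n/m⌉) * + m + defect a      ≡⟨ ⌈*n/m⌉-difference a≤b ⟩
      + (b ∸ a) * n + defect b                      <⟨ ℤ.+-monoʳ-< (+ (b ∸ a) * n) (defect<m b) ⟩
      + (b ∸ a) * n + + m                           ∎
    where open ℤ.≤-Reasoning

  multiple<m⇒≡0 : ∀ x → 0ℤ ≤ x * + m → x * + m < + m → x * + m ≡ 0ℤ
  multiple<m⇒≡0 x 0≤xm xm<m = cong (_* + m) (ℤ.≤-antisym x≤0 0≤x)
    where
    0≤x : 0ℤ ≤ x
    0≤x = ℤ.*-cancelʳ-≤-pos 0ℤ x (+ m) 0≤xm
    x≤0 : x ≤ 0ℤ
    x≤0 = ℤ.i<j⇒i≤pred[j] (ℤ.*-cancelʳ-<-nonNeg {x} {1ℤ} (+ m) (subst₂ _<_ refl (sym (ℤ.*-identityˡ (+ m))) xm<m))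

  m∣⇒defect≡0 : ∀ {i} → m ∣ i → defect i ≡ 0ℤ
  m∣⇒defect≡0 (divides k refl) = trans defect≡multiple
    (multiple<m⇒≡0 (⌈ k ℕ.* m *n/m⌉ - + k * n) (subst₂ _≤_ refl defect≡multiple (defect-nonNeg (k ℕ.* m)))
                     (subst₂ _<_ defect≡multiple refl (defect<m (k ℕ.* m))))
    where
    factor : ∀ c k q n → c * q - (k * q) * n ≡ (c - k * n) * q
    factor = solve-∀
    defect≡multiple : defect (k ℕ.* m) ≡ (⌈ k ℕ.* m *n/m⌉ - + k * n) * + m
    defect≡multiple = trans (cong (λ s → ⌈ k ℕ.* m *n/m⌉ * + m - s * n) (ℤ.pos-* k m))
                            (factor ⌈ k ℕ.* m *n/m⌉ (+ k) (+ m) n)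

  defect≡0⇒m∣ : Coprime m ∣ n ∣ → ∀ {i} → defect i ≡ 0ℤ → m ∣ i
  defect≡0⇒m∣ m⊥n {i} defect≡0 = coprime-divisor m⊥n (divides ∣ ⌈ i *n/m⌉ ∣ (begin
      ∣ n ∣ ℕ.* i                 ≡⟨ ℕ.*-comm ∣ n ∣ i ⟩
      i ℕ.* ∣ n ∣                 ≡⟨ ℤ.abs-* (+ i) n ⟨
      ∣ + i * n ∣                 ≡⟨ cong ∣_∣ (ℤ.i-j≡0⇒i≡j (⌈ i *n/m⌉ * + m) (+ i * n) defect≡0) ⟨
      ∣ ⌈ i *n/m⌉ * + m ∣         ≡⟨ ℤ.abs-* ⌈ i *n/m⌉ (+ m) ⟩
      ∣ ⌈ i *n/m⌉ ∣ ℕ.* m         ∎))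
    where open ≡-Reasoning

  ⌈*n/m⌉-tail : ∀ d {a} → a ℕ.≤ d ℕ.* m →
                (⌈ d ℕ.* m *n/m⌉ - ⌈ a *n/m⌉) * + m + defect a ≡ + (d ℕ.* m ∸ a) * n
  ⌈*n/m⌉-tail d {a} a≤dm = trans (⌈*n/m⌉-difference a≤dm)
    (trans (cong (λ e → + (d ℕ.* m ∸ a) * n + e) (m∣⇒defect≡0 (divides d refl))) (ℤ.+-identityʳ _))

  ⌈*n/m⌉-tail-≤ : ∀ d {a} → a ℕ.≤ d ℕ.* m →
                  (⌈ d ℕ.* m *n/m⌉ - ⌈ a *n/m⌉) * + m ≤ + (d ℕ.* m ∸ a) * n
  ⌈*n/m⌉-tail-≤ d {a} a≤dm =
    subst₂ _≤_ refl (⌈*n/m⌉-tail d a≤dm) (ℤ.i≤i+j _ (defect a) {{nonNegative (defect-nonNeg a)}})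

  ⌈*n/m⌉-tail-≡⇔ : Coprime m ∣ n ∣ → ∀ d {a} → a ℕ.≤ d ℕ.* m →
                   (⌈ d ℕ.* m *n/m⌉ - ⌈ a *n/m⌉) * + m ≡ + (d ℕ.* m ∸ a) * n ⇔ m ∣ a
  ⌈*n/m⌉-tail-≡⇔ m⊥n d {a} a≤dm = mk⇔
    (λ x≡y → defect≡0⇒m∣ m⊥n (+-cancelˡ-≡ x (defect a) 0ℤ
      (trans (⌈*n/m⌉-tail d a≤dm) (trans (sym x≡y) (sym (ℤ.+-identityʳ x))))))
    (λ m∣a → trans (sym (ℤ.+-identityʳ x))
      (trans (cong (λ e → x + e) (sym (m∣⇒defect≡0 m∣a))) (⌈*n/m⌉-tail d a≤dm)))
    where
    x : ℤ
    x = (⌈ d ℕ.* m *n/m⌉ - ⌈ a *n/m⌉) * + m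

  bvec-scaled : ∀ d .{{_ : NonZero d}} j →
                bvec (d ℕ.* m) {{ℕ.m*n≢0 d m}} (+ d * n) (suc j) ≡ ⌈ suc j *n/m⌉ - ⌈ j *n/m⌉
  bvec-scaled d j = cong₂ _-_ (scaled (suc j)) (scaled j)
    where
    instance
      dm≢0 : NonZero (d ℕ.* m)
      dm≢0 = ℕ.m*n≢0 d m
    identity : ∀ i d n m → i * (d * n) * m ≡ i * n * (d * m)
    identity = solve-∀
    scaled : ∀ i → ceiling ((+ i * (+ d * n)) / (d ℕ.* m)) ≡ ⌈ i *n/m⌉
    scaled i = cong ceiling (Equivalence.to (/-≡-/ (+ i * (+ d * n)) (d ℕ.* m) (+ i * n) m)
      (trans (identity (+ i) (+ d) n (+ m)) (cong (+ i * n *_) (sym (ℤ.pos-* d m)))))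

  sum-bvec-scaled : ∀ d .{{_ : NonZero d}} {a b} → a ℕ.≤ b →
                    sumInterval (bvec (d ℕ.* m) {{ℕ.m*n≢0 d m}} (+ d * n)) (suc a) b ≡ ⌈ b *n/m⌉ - ⌈ a *n/m⌉
  sum-bvec-scaled d = sumInterval-telescope (bvec (d ℕ.* m) {{ℕ.m*n≢0 d m}} (+ d * n)) ⌈_*n/m⌉ (bvec-scaled d)

open import Defs using (bvec; sumInterval)
open import Level using (0ℓ)
open import Data.Nat using (suc; _+_; _*_; _∸_; _≤_)
open import Data.Nat.Properties using (m*n≢0; <⇒≤; suc-injective)
open import Data.Nat.Divisibility using (_∣_; divides)
open import Data.Nat.Coprimality using (Coprime)
open import Data.Integer as ℤ using (+_; ∣_∣)
import Data.Integer.Properties as ℤ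
open import Data.Rational as ℚ using (1ℚ)
open import Data.Product using (_×_; ∃; _,_)
open import Relation.Binary.PropositionalEquality using (_≡_; sym; cong; subst; subst₂)
open import Function.Bundles using (_⇔_; mk⇔)
open import Function.Properties.Equivalence using (⇔-setoid)
import Function.Properties.Equivalence as ⇔
open Fraction using (/-<-/; /-≤-/; /-≡-/; /-+-1ℚ)

∣⇔suc≡1+multiple : ∀ {m a} → m ∣ a ⇔ ∃ λ k → suc a ≡ 1 + k * m
∣⇔suc≡1+multiple = mk⇔ (λ { (divides k a≡km) → k , cong suc a≡km })
                       (λ { (k , e) → divides k (suc-injective e) })

lemma8p14 : (m : ℕ) .{{_ : NonZero m}} (n : ℤ) (d : ℕ) .{{_ : NonZero d}} →
    Coprime m ∣ n ∣ →
    ((a b : ℕ) → 1 ≤ a → a ≤ b → b ≤ d * m →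
      (sumInterval (bvec (d * m) {{m*n≢0 d m}} ((+ d) ℤ.* n)) a b ℚ./ 1)
        ℚ.< (((+ (suc b ∸ a)) ℤ.* n) ℚ./ m) ℚ.+ 1ℚ)
    ×
    ((a : ℕ) → 1 ≤ a → a ≤ d * m →
      ((sumInterval (bvec (d * m) {{m*n≢0 d m}} ((+ d) ℤ.* n)) a (d * m) ℚ./ 1)
        ℚ.≤ (((+ (suc (d * m) ∸ a)) ℤ.* n) ℚ./ m))
      ×
      (((sumInterval (bvec (d * m) {{m*n≢0 d m}} ((+ d) ℤ.* n)) a (d * m) ℚ./ 1)
        ≡ (((+ (suc (d * m) ∸ a)) ℤ.* n) ℚ./ m))
        ⇔ ∃ λ k → a ≡ 1 + k * m))
lemma8p14 m n d m⊥n = part-i , part-ii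
  where
  open CeilingSequence m n

  Σb : ℕ → ℕ → ℤ
  Σb = sumInterval (bvec (d * m) {{m*n≢0 d m}} ((+ d) ℤ.* n))

  part-i : ∀ a b → 1 ≤ a → a ≤ b → b ≤ d * m →
           Σb a b ℚ./ 1 ℚ.< (+ (suc b ∸ a) ℤ.* n) ℚ./ m ℚ.+ 1ℚ
  part-i (suc a) b _ a<b _ =
    subst₂ ℚ._<_ (cong (ℚ._/ 1) (sym (sum-bvec-scaled d a≤b))) (sym (/-+-1ℚ T m))
      (/-<-/ X 1 (T ℤ.+ + m) m (subst (X ℤ.* + m ℤ.<_) (sym (ℤ.*-identityʳ (T ℤ.+ + m))) (⌈*n/m⌉-difference-< a≤b)))
    where
    a≤b : a ≤ b
    a≤b = <⇒≤ a<b
    X T : ℤ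
    X = ⌈ b *n/m⌉ ℤ.- ⌈ a *n/m⌉
    T = + (b ∸ a) ℤ.* n

  part-ii : ∀ a → 1 ≤ a → a ≤ d * m →
            (Σb a (d * m) ℚ./ 1 ℚ.≤ (+ (suc (d * m) ∸ a) ℤ.* n) ℚ./ m) ×
            (Σb a (d * m) ℚ./ 1 ≡ (+ (suc (d * m) ∸ a) ℤ.* n) ℚ./ m ⇔ ∃ λ k → a ≡ 1 + k * m)
  part-ii (suc a) _ a<dm rewrite sum-bvec-scaled d (<⇒≤ a<dm) =
      /-≤-/ X 1 T m (subst (X ℤ.* + m ℤ.≤_) (sym (ℤ.*-identityʳ T)) (⌈*n/m⌉-tail-≤ d a≤dm))
    , (begin
      X ℚ./ 1 ≡ T ℚ./ m              ≈⟨ ⇔.sym (/-≡-/ X 1 T m) ⟩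
      X ℤ.* + m ≡ T ℤ.* + 1          ≡⟨ cong (X ℤ.* + m ≡_) (ℤ.*-identityʳ T) ⟩
      X ℤ.* + m ≡ T                  ≈⟨ ⌈*n/m⌉-tail-≡⇔ m⊥n d a≤dm ⟩
      m ∣ a                          ≈⟨ ∣⇔suc≡1+multiple ⟩
      (∃ λ k → suc a ≡ 1 + k * m)    ∎)
    where
    open import Relation.Binary.Reasoning.Setoid (⇔-setoid 0ℓ)
    a≤dm : a ≤ d * m
    a≤dm = <⇒≤ a<dm
    X T : ℤ
    X = ⌈ d * m *n/m⌉ ℤ.- ⌈ a *n/m⌉
    T = + (d * m ∸ a) ℤ.* n
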